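{- If $G$ is a cubic ($3$-regular) graph, then $\mathrm{TC}_2(G)=3$ and $\mathrm{TC}_3(G)=2$.
   Context: All graphs are finite, simple and connected. For a vertex $v$, $N(v)$ denotes its open neighborhood. For a graph $G$ with minimum degree at least $k$, a set $S\subseteq V(G)$ is a total $k$-dominating set if $|N(v)\cap S|\ge k$ for every $v\in V(G)$. Two disjoint sets $U,W\subseteq V(G)$ form a total $k$-coalition if neither is a total $k$-dominating set but $U\cup W$ is. A total $k$-coalition partition of $G$ is a partition $\Omega$ of $V(G)$ such that every set of $\Omega$ forms a total $k$-coalition with some other set of $\Omega$. $\mathrm{TC}_k(G)$ is the maximum cardinality of a total $k$-coalition partition of $G$. -}

module Defs where

open import Data.Nat using (ℕ; _≤_; _<_; zero; suc)
open import Data.Bool using (Bool; true; false)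
open import Data.Fin using (Fin; _≟_)
open import Data.Fin.Subset using (Subset; _∩_; _∪_; ∣_∣)
open import Data.Vec using (tabulate)
open import Data.Product using (Σ; ∃; _×_)
open import Relation.Binary.PropositionalEquality using (_≡_; _≢_)
open import Relation.Nullary using (¬_)
open import Relation.Nullary.Decidable using (⌊_⌋)

record Graph (n : ℕ) : Set where
  field
    adj   : Fin n → Fin n → Bool
    sym   : ∀ u v → adj u v ≡ adj v u
    irrfl : ∀ v → adj v v ≡ false
open Graph public

module _ {n : ℕ} (G : Graph n) where

  N : Fin n → Subset n
  N v = tabulate (adj G v)

  degree : Fin n → ℕ
  degree v = ∣ N v ∣

  data Walk : Fin n → Fin n → Set where
    here : ∀ {u} → Walk u u
    step : ∀ {u w v} → adj G u w ≡ true → Walk w v → Walk u v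

  Connected : Set
  Connected = Fin n × (∀ u v → Walk u v)

  Cubic : Set
  Cubic = ∀ v → degree v ≡ 3

  TotalDom : ℕ → Subset n → Set
  TotalDom k S = ∀ v → k ≤ ∣ N v ∩ S ∣

  TotalCoalition : ℕ → Subset n → Subset n → Set
  TotalCoalition k U W = ¬ TotalDom k U × ¬ TotalDom k W × TotalDom k (U ∪ W)

  -- A partition of V(G) into m (nonempty) blocks, given by a surjective
  -- block-labelling f : Fin n → Fin m; block i is { v | f v ≡ i }.
  Block : ∀ {m} → (Fin n → Fin m) → Fin m → Subset n
  Block f i = tabulate (λ v → ⌊ f v ≟ i ⌋)

  Surjective : ∀ {m} → (Fin n → Fin m) → Set
  Surjective {m} f = ∀ (i : Fin m) → ∃ λ v → f v ≡ i

  IsTotalCoalitionPartition : ℕ → (m : ℕ) → (Fin n → Fin m) → Set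
  IsTotalCoalitionPartition k m f =
    Surjective f ×
    (∀ (i : Fin m) → Σ (Fin m) λ j → i ≢ j × TotalCoalition k (Block f i) (Block f j))

  HasTCPartitionOfSize : ℕ → ℕ → Set
  HasTCPartitionOfSize k m = Σ (Fin n → Fin m) (IsTotalCoalitionPartition k m)

  -- TC_k(G) = t : t is the maximum cardinality of a total k-coalition partition
  TCEq : ℕ → ℕ → Set
  TCEq k t = HasTCPartitionOfSize k t × (∀ m → HasTCPartitionOfSize k m → m ≤ t)

-- In a (k+1)-regular graph every vertex u is adjacent to some w, and all k+1 neighbours of w,
-- u among them, must lie in a total (k+1)-dominating set; so such a set is the whole vertex set.
-- A total (k+1)-coalition is therefore a pair of blocks covering V, which allows at most two
-- blocks, and any split of V into two nonempty blocks is such a partition.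
-- For k = 2 and maximum degree 3, two disjoint total 2-dominating sets would give some vertex four
-- neighbours, so any two coalitions share a block. If a block A forms coalitions with three other
-- blocks B, C, D, then at every vertex |N ∩ A| + |N ∩ X| ≥ 2 for X = B, C, D while
-- |N ∩ (A ∪ B ∪ C ∪ D)| ≤ 3, forcing |N ∩ A| ≥ 2, i.e. A alone is 2-dominating. So the coalition
-- graph on the blocks has no two disjoint edges and no vertex of degree 3, whence at most three
-- blocks; {a}, {b}, V ∖ {a, b} for two neighbours a, b of one vertex attains three.
module Submission where

open import Data.Bool using (Bool; true)
open import Data.Bool.Properties using (T-≡)
open import Data.Empty using (⊥-elim)
open import Data.Fin using (Fin; zero; suc; _≟_)
open import Data.Fin.Subset
  using (Subset; inside; outside; _∈_; _∉_; _⊆_; _∩_; _∪_; ∁; ⁅_⁆; _-_; ∣_∣; Nonempty; Empty)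
open import Data.Fin.Subset.Properties
  using (_∈?_; nonempty?; Empty-unique; ∣⊥∣≡0; ∣⁅x⁆∣≡1; ∣∁p∣≡n∸∣p∣; p⊆q⇒∣p∣≤∣q∣; ∣p∩q∣≤∣p∣; ∣p∩q∣≤∣q∣;
         x∈p⇒∣p-x∣<∣p∣; ∩-distribˡ-∪; ∪-comm; x∈p∩q⁺; x∈p∩q⁻; x∈p∪q⁺; x∈p∪q⁻; x∈⁅x⁆; x≢y⇒x∉⁅y⁆;
         x∉⁅y⁆⇒x≢y; x∈∁p⇒x∉p; x∉p⇒x∈∁p; x∈p⇒x∉∁p; x∈p∧x≢y⇒x∈p-y)
open import Data.Nat using (ℕ; zero; suc; _+_; _≤_; _<_; z≤n; s≤s; _≤?_)
open import Data.Nat.Properties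
  using (+-suc; +-comm; +-identityʳ; +-mono-≤; ≤-refl; ≤-trans; ≤-reflexive; m≤m+n; ≤-pred; ≰⇒>;
         m<n⇒0<n∸m; <⇒≢; <⇒≱; <⇒≤; ≤-<-trans; <-≤-trans; module ≤-Reasoning)
open import Data.Product using (∃; ∃₂; _×_; _,_; proj₂; map₂; uncurry)
open import Data.Sum as Sum using (_⊎_; inj₁; inj₂)
open import Data.Vec using ([]; _∷_; tabulate)
open import Data.Vec.Properties using (lookup∘tabulate; []=⇒lookup; lookup⇒[]=)
open import Function.Base using (_∘_; case_of_)
open import Function.Bundles using (Equivalence)
open import Relation.Binary.PropositionalEquality
  using (_≡_; _≢_; refl; sym; trans; cong; subst; ≢-sym; module ≡-Reasoning)
open import Relation.Nullary using (¬_; yes; no; contradiction)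
open import Relation.Nullary.Decidable using (toWitness; fromWitness; decidable-stable; from-no)

open import Defs renaming (sym to adj-sym)

∣p∪q∣+∣p∩q∣≡∣p∣+∣q∣ : ∀ {n} (p q : Subset n) → ∣ p ∪ q ∣ + ∣ p ∩ q ∣ ≡ ∣ p ∣ + ∣ q ∣
∣p∪q∣+∣p∩q∣≡∣p∣+∣q∣ []            []            = refl
∣p∪q∣+∣p∩q∣≡∣p∣+∣q∣ (outside ∷ p) (outside ∷ q) = ∣p∪q∣+∣p∩q∣≡∣p∣+∣q∣ p q
∣p∪q∣+∣p∩q∣≡∣p∣+∣q∣ (inside ∷ p)  (outside ∷ q) = cong suc (∣p∪q∣+∣p∩q∣≡∣p∣+∣q∣ p q)
∣p∪q∣+∣p∩q∣≡∣p∣+∣q∣ (outside ∷ p) (inside ∷ q)  =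
  trans (cong suc (∣p∪q∣+∣p∩q∣≡∣p∣+∣q∣ p q)) (sym (+-suc ∣ p ∣ ∣ q ∣))
∣p∪q∣+∣p∩q∣≡∣p∣+∣q∣ (inside ∷ p)  (inside ∷ q)  = cong suc (begin
  ∣ p ∪ q ∣ + suc ∣ p ∩ q ∣  ≡⟨ +-suc ∣ p ∪ q ∣ ∣ p ∩ q ∣ ⟩
  suc (∣ p ∪ q ∣ + ∣ p ∩ q ∣) ≡⟨ cong suc (∣p∪q∣+∣p∩q∣≡∣p∣+∣q∣ p q) ⟩
  suc (∣ p ∣ + ∣ q ∣)         ≡⟨ sym (+-suc ∣ p ∣ ∣ q ∣) ⟩
  ∣ p ∣ + suc ∣ q ∣           ∎)
  where open ≡-Reasoning

∣p∪q∣≤∣p∣+∣q∣ : ∀ {n} (p q : Subset n) → ∣ p ∪ q ∣ ≤ ∣ p ∣ + ∣ q ∣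
∣p∪q∣≤∣p∣+∣q∣ p q = ≤-trans (m≤m+n ∣ p ∪ q ∣ ∣ p ∩ q ∣) (≤-reflexive (∣p∪q∣+∣p∩q∣≡∣p∣+∣q∣ p q))

Empty⇒∣p∣≡0 : ∀ {n} {p : Subset n} → Empty p → ∣ p ∣ ≡ 0
Empty⇒∣p∣≡0 {n} empty = trans (cong ∣_∣ (Empty-unique empty)) (∣⊥∣≡0 n)

0<∣p∣⇒Nonempty : ∀ {n} {p : Subset n} → 0 < ∣ p ∣ → Nonempty p
0<∣p∣⇒Nonempty {p = p} 0<∣p∣ =
  decidable-stable (nonempty? p) λ empty → <⇒≢ 0<∣p∣ (sym (Empty⇒∣p∣≡0 empty))

∣p∣<n⇒∃∉ : ∀ {n} (p : Subset n) → ∣ p ∣ < n → ∃ λ x → x ∉ p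
∣p∣<n⇒∃∉ p ∣p∣<n = map₂ x∈∁p⇒x∉p
  (0<∣p∣⇒Nonempty (subst (0 <_) (sym (∣∁p∣≡n∸∣p∣ p)) (m<n⇒0<n∸m ∣p∣<n)))

Disjoint : ∀ {n} → Subset n → Subset n → Set
Disjoint p q = ∀ {x} → x ∈ p → x ∉ q

∣p∪q∣≡∣p∣+∣q∣ : ∀ {n} {p q : Subset n} → Disjoint p q → ∣ p ∪ q ∣ ≡ ∣ p ∣ + ∣ q ∣
∣p∪q∣≡∣p∣+∣q∣ {p = p} {q} p#q = begin
  ∣ p ∪ q ∣               ≡⟨ sym (+-identityʳ ∣ p ∪ q ∣) ⟩
  ∣ p ∪ q ∣ + 0           ≡⟨ cong (∣ p ∪ q ∣ +_) (sym (Empty⇒∣p∣≡0 p∩q-empty)) ⟩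
  ∣ p ∪ q ∣ + ∣ p ∩ q ∣   ≡⟨ ∣p∪q∣+∣p∩q∣≡∣p∣+∣q∣ p q ⟩
  ∣ p ∣ + ∣ q ∣           ∎
  where
  open ≡-Reasoning
  p∩q-empty : Empty (p ∩ q)
  p∩q-empty (_ , x∈p∩q) = uncurry p#q (x∈p∩q⁻ p q x∈p∩q)

∣r∩[p∪q]∣≡∣r∩p∣+∣r∩q∣ : ∀ {n} (r : Subset n) {p q : Subset n} → Disjoint p q →
                         ∣ r ∩ (p ∪ q) ∣ ≡ ∣ r ∩ p ∣ + ∣ r ∩ q ∣
∣r∩[p∪q]∣≡∣r∩p∣+∣r∩q∣ r {p} {q} p#q = trans (cong ∣_∣ (∩-distribˡ-∪ r p q)) (∣p∪q∣≡∣p∣+∣q∣ r∩p#r∩q)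
  where
  r∩p#r∩q : Disjoint (r ∩ p) (r ∩ q)
  r∩p#r∩q x∈r∩p x∈r∩q = p#q (proj₂ (x∈p∩q⁻ r p x∈r∩p)) (proj₂ (x∈p∩q⁻ r q x∈r∩q))

∣p∣≤1+∣p∩q∣ : ∀ {n} {p q : Subset n} (c : Fin n) → (∀ {x} → x ≢ c → x ∈ q) → ∣ p ∣ ≤ suc ∣ p ∩ q ∣
∣p∣≤1+∣p∩q∣ {p = p} {q} c q⊇V-c = begin
  ∣ p ∣                   ≤⟨ p⊆q⇒∣p∣≤∣q∣ p⊆p∩q∪c ⟩
  ∣ p ∩ q ∪ ⁅ c ⁆ ∣       ≤⟨ ∣p∪q∣≤∣p∣+∣q∣ (p ∩ q) ⁅ c ⁆ ⟩
  ∣ p ∩ q ∣ + ∣ ⁅ c ⁆ ∣   ≡⟨ cong (∣ p ∩ q ∣ +_) (∣⁅x⁆∣≡1 c) ⟩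
  ∣ p ∩ q ∣ + 1           ≡⟨ +-comm ∣ p ∩ q ∣ 1 ⟩
  suc ∣ p ∩ q ∣           ∎
  where
  open ≤-Reasoning
  p⊆p∩q∪c : p ⊆ p ∩ q ∪ ⁅ c ⁆
  p⊆p∩q∪c {x} x∈p with x ≟ c
  ... | yes refl = x∈p∪q⁺ (inj₂ (x∈⁅x⁆ c))
  ... | no x≢c   = x∈p∪q⁺ (inj₁ (x∈p∩q⁺ (x∈p , q⊇V-c x≢c)))

∣p∩q∣<∣p∣ : ∀ {n} {p q : Subset n} {x} → x ∈ p → x ∉ q → ∣ p ∩ q ∣ < ∣ p ∣
∣p∩q∣<∣p∣ {p = p} {q} {x} x∈p x∉q =
  ≤-<-trans (p⊆q⇒∣p∣≤∣q∣ p∩q⊆p-x) (x∈p⇒∣p-x∣<∣p∣ x∈p)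
  where
  p∩q⊆p-x : p ∩ q ⊆ p - x
  p∩q⊆p-x y∈p∩q with x∈p∩q⁻ p q y∈p∩q
  ... | y∈p , y∈q = x∈p∧x≢y⇒x∈p-y y∈p λ { refl → x∉q y∈q }

2+∣p∩q∣≤∣p∣ : ∀ {n} {p q : Subset n} {x y} → x ∈ p → y ∈ p → x ≢ y → x ∉ q → y ∉ q →
              2 + ∣ p ∩ q ∣ ≤ ∣ p ∣
2+∣p∩q∣≤∣p∣ {p = p} {q} {x} {y} x∈p y∈p x≢y x∉q y∉q = begin-strict
  suc ∣ p ∩ q ∣       ≤⟨ s≤s (p⊆q⇒∣p∣≤∣q∣ p∩q⊆p-x-y) ⟩
  suc ∣ p - x - y ∣   ≤⟨ x∈p⇒∣p-x∣<∣p∣ (x∈p∧x≢y⇒x∈p-y y∈p (x≢y ∘ sym)) ⟩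
  ∣ p - x ∣           <⟨ x∈p⇒∣p-x∣<∣p∣ x∈p ⟩
  ∣ p ∣               ∎
  where
  open ≤-Reasoning
  p∩q⊆p-x-y : p ∩ q ⊆ p - x - y
  p∩q⊆p-x-y z∈p∩q with x∈p∩q⁻ p q z∈p∩q
  ... | z∈p , z∈q = x∈p∧x≢y⇒x∈p-y (x∈p∧x≢y⇒x∈p-y z∈p λ { refl → x∉q z∈q }) λ { refl → y∉q z∈q }

2≤∣p∣⇒∃-distinct : ∀ {n} {p : Subset n} → 2 ≤ ∣ p ∣ → ∃₂ λ x y → x ∈ p × y ∈ p × x ≢ y
2≤∣p∣⇒∃-distinct {p = p} 2≤∣p∣ with 0<∣p∣⇒Nonempty (≤-trans (s≤s z≤n) 2≤∣p∣)
... | x , x∈p with 0<∣p∣⇒Nonempty {p = p ∩ ∁ ⁅ x ⁆}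
                     (≤-pred (≤-trans 2≤∣p∣ (∣p∣≤1+∣p∩q∣ {p = p} x (x∉p⇒x∈∁p ∘ x≢y⇒x∉⁅y⁆))))
... | y , y∈p∩∁x with x∈p∩q⁻ p (∁ ⁅ x ⁆) y∈p∩∁x
... | y∈p , y∈∁x = x , y , x∈p , y∈p , λ { refl → x∈p⇒x∉∁p (x∈⁅x⁆ x) y∈∁x }

∉⁅x⁆∪p⇒≢ : ∀ {n} {p : Subset n} {x y} → y ∉ ⁅ x ⁆ ∪ p → y ≢ x
∉⁅x⁆∪p⇒≢ {x = x} y∉ refl = y∉ (x∈p∪q⁺ (inj₁ (x∈⁅x⁆ x)))

∉⁅x⁆∪p⇒∉p : ∀ {n} {p : Subset n} {x y} → y ∉ ⁅ x ⁆ ∪ p → y ∉ p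
∉⁅x⁆∪p⇒∉p y∉ y∈p = y∉ (x∈p∪q⁺ (inj₂ y∈p))

∣⁅x⁆∪p∣≤1+∣p∣ : ∀ {n} (x : Fin n) (p : Subset n) → ∣ ⁅ x ⁆ ∪ p ∣ ≤ suc ∣ p ∣
∣⁅x⁆∪p∣≤1+∣p∣ x p = ≤-trans (∣p∪q∣≤∣p∣+∣q∣ ⁅ x ⁆ p) (≤-reflexive (cong (_+ ∣ p ∣) (∣⁅x⁆∣≡1 x)))

∣⁅x⁆∪⁅y⁆∣≤2 : ∀ {n} (x y : Fin n) → ∣ ⁅ x ⁆ ∪ ⁅ y ⁆ ∣ ≤ 2
∣⁅x⁆∪⁅y⁆∣≤2 x y = ≤-trans (∣⁅x⁆∪p∣≤1+∣p∣ x ⁅ y ⁆) (≤-reflexive (cong suc (∣⁅x⁆∣≡1 y)))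

∣⁅x⁆∪⁅y⁆∪⁅z⁆∣≤3 : ∀ {n} (x y z : Fin n) → ∣ ⁅ x ⁆ ∪ ⁅ y ⁆ ∪ ⁅ z ⁆ ∣ ≤ 3
∣⁅x⁆∪⁅y⁆∪⁅z⁆∣≤3 x y z = ≤-trans (∣⁅x⁆∪p∣≤1+∣p∣ x (⁅ y ⁆ ∪ ⁅ z ⁆)) (s≤s (∣⁅x⁆∪⁅y⁆∣≤2 y z))

fresh₂ : ∀ {m} → 2 < m → (i j : Fin m) → ∃ λ c → c ≢ i × c ≢ j
fresh₂ 2<m i j with ∣p∣<n⇒∃∉ (⁅ i ⁆ ∪ ⁅ j ⁆) (<-≤-trans (s≤s (∣⁅x⁆∪⁅y⁆∣≤2 i j)) 2<m)
... | c , c∉ = c , ∉⁅x⁆∪p⇒≢ c∉ , x∉⁅y⁆⇒x≢y (∉⁅x⁆∪p⇒∉p c∉)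

fresh₃ : ∀ {m} → 3 < m → (i j k : Fin m) → ∃ λ c → c ≢ i × c ≢ j × c ≢ k
fresh₃ 3<m i j k with ∣p∣<n⇒∃∉ (⁅ i ⁆ ∪ ⁅ j ⁆ ∪ ⁅ k ⁆) (<-≤-trans (s≤s (∣⁅x⁆∪⁅y⁆∪⁅z⁆∣≤3 i j k)) 3<m)
... | c , c∉ = c , ∉⁅x⁆∪p⇒≢ c∉ , ∉⁅x⁆∪p⇒≢ (∉⁅x⁆∪p⇒∉p c∉) , x∉⁅y⁆⇒x≢y (∉⁅x⁆∪p⇒∉p (∉⁅x⁆∪p⇒∉p c∉))

x∈tabulate⁺ : ∀ {n} {g : Fin n → Bool} {x} → g x ≡ true → x ∈ tabulate g
x∈tabulate⁺ {g = g} {x} gx≡true = lookup⇒[]= x (tabulate g) (trans (lookup∘tabulate g x) gx≡true)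

x∈tabulate⁻ : ∀ {n} {g : Fin n → Bool} {x} → x ∈ tabulate g → g x ≡ true
x∈tabulate⁻ {g = g} {x} x∈g = trans (sym (lookup∘tabulate g x)) ([]=⇒lookup x∈g)

star-arith : ∀ {s a c d} → 2 ≤ s → 2 ≤ a + c → 2 ≤ a + d → s + (c + d) ≤ 3 → 2 ≤ a
star-arith {a = 0} 2≤s 2≤c 2≤d ≤3 =
  contradiction (≤-trans (+-mono-≤ 2≤s (+-mono-≤ 2≤c 2≤d)) ≤3) (from-no (6 ≤? 3))
star-arith {a = 1} 2≤s 2≤1+c 2≤1+d ≤3 =
  contradiction (≤-trans (+-mono-≤ 2≤s (+-mono-≤ (≤-pred 2≤1+c) (≤-pred 2≤1+d))) ≤3) (from-no (4 ≤? 3))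
star-arith {a = suc (suc _)} _ _ _ _ = s≤s (s≤s z≤n)

isolate : ∀ {n} → Fin n → Fin n → Fin 2
isolate x u with u ≟ x
... | yes _ = zero
... | no _  = suc zero

module _ {n} {x : Fin n} where

  isolate-x : isolate x x ≡ zero
  isolate-x with x ≟ x
  ... | yes _  = refl
  ... | no x≢x = contradiction refl x≢x

  isolate-other : ∀ {u} → u ≢ x → isolate x u ≡ suc zero
  isolate-other {u} u≢x with u ≟ x
  ... | yes u≡x = contradiction u≡x u≢x
  ... | no _    = refl

isolate₂ : ∀ {n} → Fin n → Fin n → Fin n → Fin 3
isolate₂ a b u with u ≟ a | u ≟ b
... | yes _ | _     = suc zero
... | no _  | yes _ = suc (suc zero)
... | no _  | no _  = zero

module _ {n} {a b : Fin n} where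

  isolate₂-a : isolate₂ a b a ≡ suc zero
  isolate₂-a with a ≟ a
  ... | yes _  = refl
  ... | no a≢a = contradiction refl a≢a

  isolate₂-b : a ≢ b → isolate₂ a b b ≡ suc (suc zero)
  isolate₂-b a≢b with b ≟ a | b ≟ b
  ... | yes b≡a | _       = contradiction (sym b≡a) a≢b
  ... | no _    | yes _   = refl
  ... | no _    | no b≢b  = contradiction refl b≢b

  isolate₂-other : ∀ {u} → u ≢ a → u ≢ b → isolate₂ a b u ≡ zero
  isolate₂-other {u} u≢a u≢b with u ≟ a | u ≟ b
  ... | yes u≡a | _       = contradiction u≡a u≢a
  ... | no _    | yes u≡b = contradiction u≡b u≢b
  ... | no _    | no _    = refl

  isolate₂≡1⇒≡a : ∀ {u} → isolate₂ a b u ≡ suc zero → u ≡ a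
  isolate₂≡1⇒≡a {u} e with u ≟ a | u ≟ b
  ... | yes u≡a | _ = u≡a
  isolate₂≡1⇒≡a () | no _ | yes _
  isolate₂≡1⇒≡a () | no _ | no _

  isolate₂≡2⇒≡b : ∀ {u} → isolate₂ a b u ≡ suc (suc zero) → u ≡ b
  isolate₂≡2⇒≡b {u} e with u ≟ a | u ≟ b
  isolate₂≡2⇒≡b () | yes _ | _
  ... | no _ | yes u≡b = u≡b
  isolate₂≡2⇒≡b () | no _ | no _

module _ {n : ℕ} (G : Graph n) where

  Regular : ℕ → Set
  Regular k = ∀ v → degree G v ≡ k

  N-sym : ∀ {u v} → u ∈ N G v → v ∈ N G u
  N-sym {u} {v} u∈Nv = x∈tabulate⁺ (trans (adj-sym G u v) (x∈tabulate⁻ u∈Nv))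

  ∈N⇒≢ : ∀ {u v} → u ∈ N G v → u ≢ v
  ∈N⇒≢ {v = v} v∈Nv refl with trans (sym (x∈tabulate⁻ v∈Nv)) (irrfl G v)
  ... | ()

  ∣N∩S∣+∣N∩T∣≤degree : ∀ {S T} → Disjoint S T → ∀ v → ∣ N G v ∩ S ∣ + ∣ N G v ∩ T ∣ ≤ degree G v
  ∣N∩S∣+∣N∩T∣≤degree {S} {T} S#T v = begin
    ∣ N G v ∩ S ∣ + ∣ N G v ∩ T ∣  ≡⟨ ∣r∩[p∪q]∣≡∣r∩p∣+∣r∩q∣ (N G v) S#T ⟨
    ∣ N G v ∩ (S ∪ T) ∣            ≤⟨ ∣p∩q∣≤∣p∣ (N G v) (S ∪ T) ⟩
    degree G v                     ∎
    where open ≤-Reasoning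

  totalDom-disjoint : ∀ {k l S T} → Disjoint S T → TotalDom G k S → TotalDom G l T →
                      ∀ v → k + l ≤ degree G v
  totalDom-disjoint S#T domS domT v = ≤-trans (+-mono-≤ (domS v) (domT v)) (∣N∩S∣+∣N∩T∣≤degree S#T v)

  ¬totalDom-small : ∀ {k S} → Fin n → ∣ S ∣ < k → ¬ TotalDom G k S
  ¬totalDom-small {S = S} v ∣S∣<k dom = <⇒≱ ∣S∣<k (≤-trans (dom v) (∣p∩q∣≤∣q∣ (N G v) S))

  regular⇒neighbour : ∀ {k} → Regular (suc k) → ∀ v → ∃ λ u → u ∈ N G v
  regular⇒neighbour regular v = 0<∣p∣⇒Nonempty (subst (0 <_) (sym (regular v)) (s≤s z≤n))

  totalDom⇒full : ∀ {k S} → Regular (suc k) → TotalDom G (suc k) S → ∀ u → u ∈ S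
  totalDom⇒full {k} {S} regular dom u = decidable-stable (u ∈? S) λ u∉S →
    let w , w∈Nu = regular⇒neighbour regular u
    in <⇒≱ (subst (∣ N G w ∩ S ∣ <_) (regular w) (∣p∩q∣<∣p∣ (N-sym w∈Nu) u∉S)) (dom w)

  full⇒totalDom : ∀ {k S} → Regular k → (∀ u → u ∈ S) → TotalDom G k S
  full⇒totalDom {S = S} regular full v =
    subst (_≤ ∣ N G v ∩ S ∣) (regular v) (p⊆q⇒∣p∣≤∣q∣ {p = N G v} λ {u} u∈Nv → x∈p∩q⁺ (u∈Nv , full u))

  totalDom-∪-comm : ∀ {k} S T → TotalDom G k (S ∪ T) → TotalDom G k (T ∪ S)
  totalDom-∪-comm {k} S T = subst (TotalDom G k) (∪-comm S T)

  coalition-sym : ∀ {k U W} → TotalCoalition G k U W → TotalCoalition G k W U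
  coalition-sym {U = U} {W} (¬domU , ¬domW , domU∪W) = ¬domW , ¬domU , totalDom-∪-comm U W domU∪W

  module _ {m : ℕ} (f : Fin n → Fin m) where

    private
      B : Fin m → Subset n
      B = Block G f

    ∈Block⁺ : ∀ {u i} → f u ≡ i → u ∈ B i
    ∈Block⁺ {u} {i} fu≡i = x∈tabulate⁺ (Equivalence.to T-≡ (fromWitness fu≡i))

    ∈Block⁻ : ∀ {u i} → u ∈ B i → f u ≡ i
    ∈Block⁻ u∈Bi = toWitness (Equivalence.from T-≡ (x∈tabulate⁻ u∈Bi))

    ∈Block∪Block⁻ : ∀ {u i j} → u ∈ B i ∪ B j → f u ≡ i ⊎ f u ≡ j
    ∈Block∪Block⁻ {i = i} {j} u∈Bi∪Bj = Sum.map ∈Block⁻ ∈Block⁻ (x∈p∪q⁻ (B i) (B j) u∈Bi∪Bj)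

    Block-disjoint : ∀ {i j} → i ≢ j → Disjoint (B i) (B j)
    Block-disjoint i≢j u∈Bi u∈Bj = i≢j (trans (sym (∈Block⁻ u∈Bi)) (∈Block⁻ u∈Bj))

    Block∪Block-disjoint : ∀ {i j k l} → i ≢ k → i ≢ l → j ≢ k → j ≢ l →
                           Disjoint (B i ∪ B j) (B k ∪ B l)
    Block∪Block-disjoint i≢k i≢l j≢k j≢l u∈Bi∪Bj u∈Bk∪Bl
      with ∈Block∪Block⁻ u∈Bi∪Bj | ∈Block∪Block⁻ u∈Bk∪Bl
    ... | inj₁ fu≡i | inj₁ fu≡k = i≢k (trans (sym fu≡i) fu≡k)
    ... | inj₁ fu≡i | inj₂ fu≡l = i≢l (trans (sym fu≡i) fu≡l)
    ... | inj₂ fu≡j | inj₁ fu≡k = j≢k (trans (sym fu≡j) fu≡k)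
    ... | inj₂ fu≡j | inj₂ fu≡l = j≢l (trans (sym fu≡j) fu≡l)

    ¬totalDom-Block : ∀ {k u i} → Regular (suc k) → f u ≢ i → ¬ TotalDom G (suc k) (B i)
    ¬totalDom-Block {u = u} regular fu≢i dom = fu≢i (∈Block⁻ (totalDom⇒full regular dom u))

    regular⇒tc-partition-size≤2 : ∀ {k} → Regular (suc k) → Fin n →
                                  IsTotalCoalitionPartition G (suc k) m f → m ≤ 2
    regular⇒tc-partition-size≤2 regular v₀ (surjective , partner) with m ≤? 2
    ... | yes m≤2 = m≤2
    ... | no m≰2 with partner (f v₀)
    ... | b , _ , _ , _ , dom-ab with fresh₂ (≰⇒> m≰2) (f v₀) b
    ... | c , c≢a , c≢b with surjective c
    ... | u , refl = ⊥-elim (Sum.[ c≢a , c≢b ] (∈Block∪Block⁻ (totalDom⇒full regular dom-ab u)))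

    module _ (degree≤3 : ∀ v → degree G v ≤ 3) where

      ¬totalDom₂-disjoint-pair : ∀ {i j k l} → Fin n → TotalDom G 2 (B i ∪ B j) →
                                 i ≢ k → i ≢ l → j ≢ k → j ≢ l → ¬ TotalDom G 2 (B k ∪ B l)
      ¬totalDom₂-disjoint-pair v₀ dom-ij i≢k i≢l j≢k j≢l dom-kl = contradiction
        (≤-trans (totalDom-disjoint (Block∪Block-disjoint i≢k i≢l j≢k j≢l) dom-ij dom-kl v₀)
                 (degree≤3 v₀))
        (from-no (4 ≤? 3))

      totalDom₂-star : ∀ {a b c d} → a ≢ c → a ≢ d → b ≢ c → b ≢ d → c ≢ d →
                       TotalDom G 2 (B a ∪ B b) → TotalDom G 2 (B a ∪ B c) → TotalDom G 2 (B a ∪ B d) →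
                       TotalDom G 2 (B a)
      totalDom₂-star {a} {b} {c} {d} a≢c a≢d b≢c b≢d c≢d dom-ab dom-ac dom-ad v =
        star-arith (dom-ab v) (split a≢c (dom-ac v)) (split a≢d (dom-ad v))
                   (≤-trans sum≤degree (degree≤3 v))
        where
        split : ∀ {x y} → x ≢ y → 2 ≤ ∣ N G v ∩ (B x ∪ B y) ∣ → 2 ≤ ∣ N G v ∩ B x ∣ + ∣ N G v ∩ B y ∣
        split x≢y = subst (2 ≤_) (∣r∩[p∪q]∣≡∣r∩p∣+∣r∩q∣ (N G v) (Block-disjoint x≢y))
        sum≤degree : ∣ N G v ∩ (B a ∪ B b) ∣ + (∣ N G v ∩ B c ∣ + ∣ N G v ∩ B d ∣) ≤ degree G v
        sum≤degree = subst (λ t → ∣ N G v ∩ (B a ∪ B b) ∣ + t ≤ degree G v)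
                       (∣r∩[p∪q]∣≡∣r∩p∣+∣r∩q∣ (N G v) (Block-disjoint c≢d))
                       (∣N∩S∣+∣N∩T∣≤degree (Block∪Block-disjoint a≢c a≢d b≢c b≢d) v)

      partner-∈ : ∀ {a b c c'} → Fin n → TotalDom G 2 (B a ∪ B b) → TotalDom G 2 (B c ∪ B c') →
                  c ≢ a → c ≢ b → c' ≡ a ⊎ c' ≡ b
      partner-∈ {a} {b} {c} {c'} v₀ dom-ab dom-cc' c≢a c≢b with c' ≟ a | c' ≟ b
      ... | yes c'≡a | _        = inj₁ c'≡a
      ... | no _     | yes c'≡b = inj₂ c'≡b
      ... | no c'≢a  | no c'≢b  = ⊥-elim
        (¬totalDom₂-disjoint-pair v₀ dom-ab (≢-sym c≢a) (≢-sym c'≢a) (≢-sym c≢b) (≢-sym c'≢b) dom-cc')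

      tc₂-partition-size≤3 : Fin n → IsTotalCoalitionPartition G 2 m f → m ≤ 3
      -- The partners c' and d' of two further blocks c and d lie in {a, b}: if they coincide, that
      -- block is the centre of a star; otherwise {c, c'} and {d, d'} are disjoint coalitions.
      tc₂-partition-size≤3 v₀ (_ , partner) with m ≤? 3
      ... | yes m≤3 = m≤3
      ... | no m≰3 with f v₀ | partner (f v₀)
      ... | a | b , a≢b , ¬dom-a , ¬dom-b , dom-ab with fresh₂ (<⇒≤ (≰⇒> m≰3)) a b
      ... | c , c≢a , c≢b with fresh₃ (≰⇒> m≰3) a b c
      ... | d , d≢a , d≢b , d≢c with partner c | partner d
      ... | c' , _ , _ , _ , dom-cc' | d' , _ , _ , _ , dom-dd'
          with partner-∈ v₀ dom-ab dom-cc' c≢a c≢b | partner-∈ v₀ dom-ab dom-dd' d≢a d≢b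
      ... | inj₁ refl | inj₁ refl = ⊥-elim (¬dom-a (totalDom₂-star
              (≢-sym c≢a) (≢-sym d≢a) (≢-sym c≢b) (≢-sym d≢b) (≢-sym d≢c)
              dom-ab (totalDom-∪-comm (B c) (B a) dom-cc') (totalDom-∪-comm (B d) (B a) dom-dd')))
      ... | inj₂ refl | inj₂ refl = ⊥-elim (¬dom-b (totalDom₂-star
              (≢-sym c≢b) (≢-sym d≢b) (≢-sym c≢a) (≢-sym d≢a) (≢-sym d≢c)
              (totalDom-∪-comm (B a) (B b) dom-ab) (totalDom-∪-comm (B c) (B b) dom-cc')
              (totalDom-∪-comm (B d) (B b) dom-dd')))
      ... | inj₁ refl | inj₂ refl = ⊥-elim
              (¬totalDom₂-disjoint-pair v₀ dom-cc' (≢-sym d≢c) c≢b (≢-sym d≢a) a≢b dom-dd')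
      ... | inj₂ refl | inj₁ refl = ⊥-elim
              (¬totalDom₂-disjoint-pair v₀ dom-cc' (≢-sym d≢c) c≢a (≢-sym d≢b) (≢-sym a≢b) dom-dd')

  surjective⇒tc-partition : ∀ {k} → Regular (suc k) → (f : Fin n → Fin 2) → Surjective G f →
                             IsTotalCoalitionPartition G (suc k) 2 f
  surjective⇒tc-partition {k} regular f surjective = surjective , λ where
      zero       → suc zero , (λ ()) , coalition-01
      (suc zero) → zero , (λ ()) , coalition-sym coalition-01
    where
    ¬dom : ∀ i j → i ≢ j → ¬ TotalDom G (suc k) (Block G f i)
    ¬dom i j i≢j with surjective j
    ... | u , fu≡j = ¬totalDom-Block f regular λ fu≡i → i≢j (trans (sym fu≡i) fu≡j)
    cover : ∀ u → u ∈ Block G f zero ∪ Block G f (suc zero)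
    cover u with f u in fu≡
    ... | zero     = x∈p∪q⁺ (inj₁ (∈Block⁺ f fu≡))
    ... | suc zero = x∈p∪q⁺ (inj₂ (∈Block⁺ f fu≡))
    coalition-01 : TotalCoalition G (suc k) (Block G f zero) (Block G f (suc zero))
    coalition-01 =
      ¬dom zero (suc zero) (λ ()) , ¬dom (suc zero) zero (λ ()) , full⇒totalDom regular cover

  regular⇒tc-partition-of-size-2 : ∀ {k} → Regular (suc k) → Fin n → HasTCPartitionOfSize G (suc k) 2
  regular⇒tc-partition-of-size-2 regular x with regular⇒neighbour regular x
  ... | y , y∈Nx = isolate x , surjective⇒tc-partition regular (isolate x) surjective
    where
    surjective : Surjective G (isolate x)
    surjective zero       = x , isolate-x
    surjective (suc zero) = y , isolate-other (∈N⇒≢ y∈Nx)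

  all-but-one⇒totalDom : ∀ {k S} → Regular (suc k) → (c : Fin n) → (∀ {u} → u ≢ c → u ∈ S) →
                         TotalDom G k S
  all-but-one⇒totalDom {S = S} regular c S⊇V-c v =
    ≤-pred (subst (_≤ suc ∣ N G v ∩ S ∣) (regular v) (∣p∣≤1+∣p∩q∣ {p = N G v} c S⊇V-c))

  module _ (cubic : Cubic G) {x a b : Fin n} (a∈Nx : a ∈ N G x) (b∈Nx : b ∈ N G x) (a≢b : a ≢ b) where

    private
      B : Fin 3 → Subset n
      B = Block G (isolate₂ a b)

      ∣Block∣≤1 : ∀ {i c} → (∀ {u} → isolate₂ a b u ≡ i → u ≡ c) → ∣ B i ∣ ≤ 1
      ∣Block∣≤1 {c = c} Bi⊆c = ≤-trans
        (p⊆q⇒∣p∣≤∣q∣ λ u∈Bi → subst (_∈ ⁅ c ⁆) (sym (Bi⊆c (∈Block⁻ (isolate₂ a b) u∈Bi))) (x∈⁅x⁆ c))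
        (≤-reflexive (∣⁅x⁆∣≡1 c))

      ¬dom-1 : ¬ TotalDom G 2 (B (suc zero))
      ¬dom-1 = ¬totalDom-small x (s≤s (∣Block∣≤1 isolate₂≡1⇒≡a))

      ¬dom-2 : ¬ TotalDom G 2 (B (suc (suc zero)))
      ¬dom-2 = ¬totalDom-small x (s≤s (∣Block∣≤1 isolate₂≡2⇒≡b))

      ¬dom-0 : ¬ TotalDom G 2 (B zero)
      ¬dom-0 dom = contradiction (≤-trans (+-mono-≤ (≤-refl {2}) (dom x)) Nx-a-b) (from-no (4 ≤? 3))
        where
        a∉B0 : a ∉ B zero
        a∉B0 a∈B0 = contradiction (trans (sym isolate₂-a) (∈Block⁻ (isolate₂ a b) a∈B0)) λ ()
        b∉B0 : b ∉ B zero
        b∉B0 b∈B0 = contradiction (trans (sym (isolate₂-b a≢b)) (∈Block⁻ (isolate₂ a b) b∈B0)) λ ()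
        Nx-a-b : 2 + ∣ N G x ∩ B zero ∣ ≤ 3
        Nx-a-b = subst (2 + ∣ N G x ∩ B zero ∣ ≤_) (cubic x) (2+∣p∩q∣≤∣p∣ a∈Nx b∈Nx a≢b a∉B0 b∉B0)

      dom-01 : TotalDom G 2 (B zero ∪ B (suc zero))
      dom-01 = all-but-one⇒totalDom cubic b λ {u} u≢b → x∈p∪q⁺ (case u ≟ a of λ where
        (yes refl) → inj₂ (∈Block⁺ (isolate₂ a b) isolate₂-a)
        (no u≢a)   → inj₁ (∈Block⁺ (isolate₂ a b) (isolate₂-other u≢a u≢b)))

      dom-20 : TotalDom G 2 (B (suc (suc zero)) ∪ B zero)
      dom-20 = all-but-one⇒totalDom cubic a λ {u} u≢a → x∈p∪q⁺ (case u ≟ b of λ where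
        (yes refl) → inj₁ (∈Block⁺ (isolate₂ a b) (isolate₂-b a≢b))
        (no u≢b)   → inj₂ (∈Block⁺ (isolate₂ a b) (isolate₂-other u≢a u≢b)))

    isolate₂-tc₂-partition : IsTotalCoalitionPartition G 2 3 (isolate₂ a b)
    isolate₂-tc₂-partition = surjective , λ where
        zero             → suc zero , (λ ()) , coalition-01
        (suc zero)       → zero , (λ ()) , coalition-sym coalition-01
        (suc (suc zero)) → zero , (λ ()) , ¬dom-2 , ¬dom-0 , dom-20
      where
      coalition-01 : TotalCoalition G 2 (B zero) (B (suc zero))
      coalition-01 = ¬dom-0 , ¬dom-1 , dom-01
      surjective : Surjective G (isolate₂ a b)
      surjective zero             = x , isolate₂-other (≢-sym (∈N⇒≢ a∈Nx)) (≢-sym (∈N⇒≢ b∈Nx))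
      surjective (suc zero)       = a , isolate₂-a
      surjective (suc (suc zero)) = b , isolate₂-b a≢b

  cubic⇒tc₂-partition-of-size-3 : Cubic G → Fin n → HasTCPartitionOfSize G 2 3
  cubic⇒tc₂-partition-of-size-3 cubic x
    with 2≤∣p∣⇒∃-distinct (subst (2 ≤_) (sym (cubic x)) (s≤s (s≤s z≤n)))
  ... | a , b , a∈Nx , b∈Nx , a≢b = isolate₂ a b , isolate₂-tc₂-partition cubic a∈Nx b∈Nx a≢b

theorem3p6 : ∀ {n : ℕ} (G : Graph n) → Connected G → Cubic G →
    TCEq G 2 3 × TCEq G 3 2
theorem3p6 G (x , _) cubic =
  (cubic⇒tc₂-partition-of-size-3 G cubic x ,
   λ _ (f , P) → tc₂-partition-size≤3 G f (≤-reflexive ∘ cubic) x P) ,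
  (regular⇒tc-partition-of-size-2 G cubic x ,
   λ _ (f , P) → regular⇒tc-partition-size≤2 G f cubic x P)
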